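{- For every $A\subseteq 2^\omega$, the partial order $\mathbb{P}(A)$ satisfies the countable chain condition.
   Context: For $A\subseteq 2^\omega$, $\mathbb{P}(A)$ is the set of finite sets $p$ of formal sentences of the following three kinds: (i) $\text{``}x\in\bigcap_{m<\omega}U_{nm}\text{''}$ with $x\in A$, $n\in\omega$; (ii) $\text{``}x\notin U_{nm}\text{''}$ with $x\in 2^\omega$, $n,m\in\omega$; (iii) $\text{``}[s]\subseteq U_{nm}\text{''}$ with $s\in 2^{<\omega}$, $n,m\in\omega$; such that $p$ is consistent, meaning: $p$ does not contain both $\text{``}x\in\bigcap_{m<\omega}U_{nm}\text{''}$ and $\text{``}x\notin U_{nk}\text{''}$ for any $x,n,k$, and $p$ does not contain both $\text{``}x\notin U_{nm}\text{''}$ and $\text{``}[x\upharpoonright k]\subseteq U_{nm}\text{''}$ for any $x,n,m,k$. The order is $p\leq q$ iff $p\supseteq q$; two conditions are compatible iff their union is a condition. -}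

module Defs where

open import Data.Nat using (ℕ)
open import Data.Bool using (Bool)
open import Data.List using (List; []; _∷_; _++_)
open import Data.List.Membership.Propositional using (_∈_)
open import Data.Product using (Σ; ∃; _×_; proj₁)
open import Relation.Nullary using (¬_)
open import Relation.Binary.PropositionalEquality using (_≡_)

Real : Set
Real = ℕ → Bool

_≈ᵣ_ : Real → Real → Set
x ≈ᵣ y = ∀ k → x k ≡ y k

restrict : Real → ℕ → List Bool
restrict x ℕ.zero = []
restrict x (ℕ.suc k) = x 0 ∷ restrict (λ i → x (ℕ.suc i)) k

data Sentence (A : Real → Set) : Set where
  -- "x ∈ ⋂_m U_{n m}"  with x ∈ A
  inG   : (x : Real) → A x → (n : ℕ) → Sentence A
  -- "x ∉ U_{n m}"
  notIn : (x : Real) → (n m : ℕ) → Sentence A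
  -- "[s] ⊆ U_{n m}"
  cyl   : (s : List Bool) → (n m : ℕ) → Sentence A

Consistent : {A : Real → Set} → List (Sentence A) → Set
Consistent {A} p =
  (∀ (x : Real) (a : A x) (n : ℕ) (x' : Real) (k : ℕ) →
     inG x a n ∈ p → notIn x' n k ∈ p → ¬ (x ≈ᵣ x'))
  × (∀ (x : Real) (n m : ℕ) (s : List Bool) (k : ℕ) →
     notIn x n m ∈ p → cyl s n m ∈ p → ¬ (s ≡ restrict x k))

Cond : (A : Real → Set) → Set
Cond A = Σ (List (Sentence A)) Consistent

Compatible : {A : Real → Set} → Cond A → Cond A → Set
Compatible p q = Consistent (proj₁ p ++ proj₁ q)

IsAntichain : {A : Real → Set} {I : Set} → (I → Cond A) → Set
IsAntichain {I = I} p = ∀ (i j : I) → Compatible (p i) (p j) → i ≡ j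

Countable : Set → Set
Countable I = ∃ λ (f : I → ℕ) → ∀ i j → f i ≡ f j → i ≡ j

CCC : (A : Real → Set) → Set₁
CCC A = ∀ (I : Set) (p : I → Cond A) → IsAntichain p → Countable I

-- ℙ(A) is σ-centred. Given a condition p, pick K so large that whenever p contains
-- "x ∈ ⋂ₘ Uₙₘ" and "y ∉ Uₙₖ" the reals x and y already differ below K (excluded middle
-- turns x ≠ y into a witness of the difference), and sketch p by truncating every real
-- it mentions to length K. If p and q have the same K and the same sketch, their union
-- is consistent: a clash between "x ∈ ⋂ₘ Uₙₘ" ∈ p and "x ∉ Uₙₖ" ∈ q would produce some
-- "y ∉ Uₙₖ" ∈ p with y ↾ K = x ↾ K, against the choice of K, and a clash between
-- "x ∉ Uₙₘ" ∈ p and "[s] ⊆ Uₙₘ" ∈ q would already be one inside p. The pairs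
-- (K, sketch) are countable, so the code of a condition injects any antichain into ℕ.
module Submission where

open import Defs
open import Level using (0ℓ)
open import Axiom.ExcludedMiddle using (ExcludedMiddle)
open import Axiom.DoubleNegationElimination using (DoubleNegationElimination; em⇒dne)
open import Data.Bool using (Bool; true; false)
open import Data.Empty using (⊥-elim)
open import Data.List using (List; []; _∷_; _++_; map)
open import Data.List.Properties using (∷-injective)
open import Data.List.Membership.Propositional using (_∈_)
open import Data.List.Membership.Propositional.Properties using (∈-map⁺; ∈-map⁻; ∈-++⁻)
open import Data.List.Relation.Unary.Any using (here; there)
open import Data.Nat using (ℕ; zero; suc; s≤s; _≤_; _<_; _⊔_; _≟_)
open import Data.Nat.Properties using (≤-trans; ≤-refl; m≤m⊔n; m≤n⊔m)
open import Data.Nat.Binary using (ℕᵇ; 2[1+_]; 1+[2_]) renaming (zero to 0ᵇ; toℕ to ℕᵇ⇒ℕ)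
open import Data.Nat.Binary.Properties using (2[1+_]-injective; 1+[2_]-injective; toℕ-injective)
open import Data.Product using (∃-syntax; _×_; _,_; proj₁; proj₂)
open import Data.Product.Properties using (,-injective)
open import Data.Sum using ([_,_]′)
open import Data.Unit using (⊤; tt)
open import Function using (_∘_)
open import Function.Definitions using (Injective)
open import Relation.Nullary using (¬_; yes; no)
open import Relation.Binary.PropositionalEquality using (_≡_; _≢_; refl; sym; trans; cong; subst)

private
  variable
    X Y : Set
    K K′ i n : ℕ
    x y : Real

record PrefixCode (X : Set) : Set where
  field
    encode           : X → List Bool → List Bool
    encode-injective : ∀ {x x′ r r′} → encode x r ≡ encode x′ r′ → x ≡ x′ × r ≡ r′

open PrefixCode

bool : PrefixCode Bool
bool = record { encode = _∷_ ; encode-injective = ∷-injective }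

unary : PrefixCode ℕ
unary = record { encode = go ; encode-injective = go-injective }
  where
  go : ℕ → List Bool → List Bool
  go zero    r = false ∷ r
  go (suc n) r = true ∷ go n r

  go-injective : ∀ {n n′ r r′} → go n r ≡ go n′ r′ → n ≡ n′ × r ≡ r′
  go-injective {zero}  {zero}   refl = refl , refl
  go-injective {suc n} {suc n′} e with go-injective (proj₂ (∷-injective e))
  ... | refl , refl = refl , refl

list : {X : Set} → PrefixCode X → PrefixCode (List X)
list {X} c = record { encode = go ; encode-injective = go-injective }
  where
  go : List X → List Bool → List Bool
  go []       r = false ∷ r
  go (x ∷ xs) r = true ∷ encode c x (go xs r)

  go-injective : ∀ {xs xs′ r r′} → go xs r ≡ go xs′ r′ → xs ≡ xs′ × r ≡ r′
  go-injective {[]}    {[]}    refl = refl , refl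
  go-injective {_ ∷ _} {_ ∷ _} e with encode-injective c (proj₂ (∷-injective e))
  ... | refl , e′ with go-injective e′
  ... | refl , refl = refl , refl

infixr 2 _×ᶜ_

_×ᶜ_ : {X Y : Set} → PrefixCode X → PrefixCode Y → PrefixCode (X × Y)
_×ᶜ_ {X} {Y} cx cy = record { encode = go ; encode-injective = go-injective }
  where
  go : X × Y → List Bool → List Bool
  go (x , y) r = encode cx x (encode cy y r)

  go-injective : ∀ {xy xy′ r r′} → go xy r ≡ go xy′ r′ → xy ≡ xy′ × r ≡ r′
  go-injective {_ , _} {_ , _} e with encode-injective cx e
  ... | refl , e′ with encode-injective cy e′
  ... | refl , refl = refl , refl

comap : (f : X → Y) → Injective _≡_ _≡_ f → PrefixCode Y → PrefixCode X
comap f f-injective c = record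
  { encode           = encode c ∘ f
  ; encode-injective = λ e → let fx≡fx′ , r≡r′ = encode-injective c e in f-injective fx≡fx′ , r≡r′
  }

-- Bit strings read as bijective base-2 numerals, which are exactly the ℕᵇ terms.
bits⇒ℕᵇ : List Bool → ℕᵇ
bits⇒ℕᵇ []           = 0ᵇ
bits⇒ℕᵇ (false ∷ bs) = 1+[2 bits⇒ℕᵇ bs ]
bits⇒ℕᵇ (true ∷ bs)  = 2[1+ bits⇒ℕᵇ bs ]

bits⇒ℕᵇ-injective : Injective _≡_ _≡_ bits⇒ℕᵇ
bits⇒ℕᵇ-injective {[]}         {[]}          refl = refl
bits⇒ℕᵇ-injective {false ∷ bs} {false ∷ bs′} e    = cong (false ∷_) (bits⇒ℕᵇ-injective (1+[2_]-injective e))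
bits⇒ℕᵇ-injective {true ∷ bs}  {true ∷ bs′}  e    = cong (true ∷_) (bits⇒ℕᵇ-injective (2[1+_]-injective e))
bits⇒ℕᵇ-injective {[]}        {false ∷ _} ()
bits⇒ℕᵇ-injective {[]}        {true ∷ _}  ()
bits⇒ℕᵇ-injective {false ∷ _} {[]}        ()
bits⇒ℕᵇ-injective {false ∷ _} {true ∷ _}  ()
bits⇒ℕᵇ-injective {true ∷ _}  {[]}        ()
bits⇒ℕᵇ-injective {true ∷ _}  {false ∷ _} ()

index : PrefixCode X → X → ℕ
index c x = ℕᵇ⇒ℕ (bits⇒ℕᵇ (encode c x []))

index-injective : (c : PrefixCode X) → Injective _≡_ _≡_ (index c)
index-injective c = proj₁ ∘ encode-injective c ∘ bits⇒ℕᵇ-injective ∘ toℕ-injective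

DifferBelow : ℕ → Real → Real → Set
DifferBelow K x y = ∃[ i ] i < K × x i ≢ y i

DifferBelow-mono : K ≤ K′ → DifferBelow K x y → DifferBelow K′ x y
DifferBelow-mono K≤K′ (i , i<K , xi≢yi) = i , ≤-trans i<K K≤K′ , xi≢yi

restrict-≡⇒≡ : restrict x K ≡ restrict y K → i < K → x i ≡ y i
restrict-≡⇒≡ {K = suc K} {i = zero}  e _ = proj₁ (∷-injective e)
restrict-≡⇒≡ {K = suc K} {i = suc i} e (s≤s i<K) = restrict-≡⇒≡ (proj₂ (∷-injective e)) i<K

≉ᵣ⇒∃≢ : DoubleNegationElimination 0ℓ → ¬ (x ≈ᵣ y) → ∃[ i ] x i ≢ y i
≉ᵣ⇒∃≢ dne x≉y = dne λ ∄≢ → x≉y λ k → dne λ xk≢yk → ∄≢ (k , xk≢yk)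

uniform-bound : {S : Set} (Q : ℕ → S → Set) → (∀ {K K′ s} → K ≤ K′ → Q K s → Q K′ s) →
                (l : List S) → (∀ {s} → s ∈ l → ∃[ K ] Q K s) → ∃[ K ] (∀ {s} → s ∈ l → Q K s)
uniform-bound Q mono []      bound = 0 , λ ()
uniform-bound Q mono (s ∷ l) bound with bound (here refl) | uniform-bound Q mono l (bound ∘ there)
... | K₁ , q₁ | K₂ , q₂ = K₁ ⊔ K₂ , λ where
  (here refl) → mono (m≤m⊔n K₁ K₂) q₁
  (there s∈l) → mono (m≤n⊔m K₁ K₂) (q₂ s∈l)

map-≡-∈⁻ : {f : X → Y} {xs ys : List X} {z : X} →
           map f xs ≡ map f ys → z ∈ ys → ∃[ w ] w ∈ xs × f z ≡ f w
map-≡-∈⁻ {f = f} e z∈ys = ∈-map⁻ f (subst (_ ∈_) (sym e) (∈-map⁺ f z∈ys))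

data Sketch : Set where
  inGˢ   : List Bool → ℕ → Sketch
  notInˢ : List Bool → ℕ → ℕ → Sketch
  cylˢ   : List Bool → ℕ → ℕ → Sketch

sketch-fields : Sketch → ℕ × List Bool × ℕ × ℕ
sketch-fields (inGˢ s n)     = 0 , s , n , 0
sketch-fields (notInˢ s n m) = 1 , s , n , m
sketch-fields (cylˢ s n m)   = 2 , s , n , m

sketch-fields-injective : Injective _≡_ _≡_ sketch-fields
sketch-fields-injective {inGˢ _ _}     {inGˢ _ _}     refl = refl
sketch-fields-injective {notInˢ _ _ _} {notInˢ _ _ _} refl = refl
sketch-fields-injective {cylˢ _ _ _}   {cylˢ _ _ _}   refl = refl

sketchCode : PrefixCode Sketch
sketchCode = comap sketch-fields sketch-fields-injective (unary ×ᶜ list bool ×ᶜ unary ×ᶜ unary)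

module _ {A : Real → Set} where

  private
    Sentences : Set
    Sentences = List (Sentence A)

  MembershipCoherent : Sentences → Sentences → Set
  MembershipCoherent p q = ∀ (x : Real) (a : A x) (n : ℕ) (x′ : Real) (k : ℕ) →
    inG x a n ∈ p → notIn x′ n k ∈ q → ¬ (x ≈ᵣ x′)

  CylinderCoherent : Sentences → Sentences → Set
  CylinderCoherent p q = ∀ (x : Real) (n m : ℕ) (s : List Bool) (k : ℕ) →
    notIn x n m ∈ p → cyl s n m ∈ q → ¬ (s ≡ restrict x k)

  -- Consistent p unfolds to Coherent p p.
  Coherent : Sentences → Sentences → Set
  Coherent p q = MembershipCoherent p q × CylinderCoherent p q

  Coherent-++ˡ : ∀ {p q r} → Coherent p r → Coherent q r → Coherent (p ++ q) r
  Coherent-++ˡ {p} (m₁ , c₁) (m₂ , c₂) =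
      (λ x a n x′ k x∈ x′∈ → [ (λ x∈p → m₁ x a n x′ k x∈p x′∈) , (λ x∈q → m₂ x a n x′ k x∈q x′∈) ]′ (∈-++⁻ p x∈))
    , (λ x n m s k x∈ s∈ → [ (λ x∈p → c₁ x n m s k x∈p s∈) , (λ x∈q → c₂ x n m s k x∈q s∈) ]′ (∈-++⁻ p x∈))

  Coherent-++ʳ : ∀ {p q r} → Coherent p q → Coherent p r → Coherent p (q ++ r)
  Coherent-++ʳ {q = q} (m₁ , c₁) (m₂ , c₂) =
      (λ x a n x′ k x∈ x′∈ → [ m₁ x a n x′ k x∈ , m₂ x a n x′ k x∈ ]′ (∈-++⁻ q x′∈))
    , (λ x n m s k x∈ s∈ → [ c₁ x n m s k x∈ , c₂ x n m s k x∈ ]′ (∈-++⁻ q s∈))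

  Consistent-++ : ∀ {p q} → Consistent p → Consistent q → Coherent p q → Coherent q p → Consistent (p ++ q)
  Consistent-++ cp cq cpq cqp = Coherent-++ˡ (Coherent-++ʳ cp cpq) (Coherent-++ʳ cqp cq)

  SeparatedPair : ℕ → Sentence A → Sentence A → Set
  SeparatedPair K (inG x _ n) (notIn y n′ _) = n ≡ n′ → DifferBelow K x y
  SeparatedPair K _           _              = ⊤

  SeparatedPair-mono : ∀ s t → K ≤ K′ → SeparatedPair K s t → SeparatedPair K′ s t
  SeparatedPair-mono (inG _ _ _)   (notIn _ _ _) K≤K′ sep n≡n′ = DifferBelow-mono K≤K′ (sep n≡n′)
  SeparatedPair-mono (inG _ _ _)   (inG _ _ _)   _    _        = tt
  SeparatedPair-mono (inG _ _ _)   (cyl _ _ _)   _    _        = tt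
  SeparatedPair-mono (notIn _ _ _) _             _    _        = tt
  SeparatedPair-mono (cyl _ _ _)   _             _    _        = tt

  Separates : ℕ → Sentences → Set
  Separates K p = ∀ {s} → s ∈ p → ∀ {t} → t ∈ p → SeparatedPair K s t

  separatedPair : DoubleNegationElimination 0ℓ → ∀ {p s t} → Consistent p →
                  s ∈ p → t ∈ p → ∃[ K ] SeparatedPair K s t
  separatedPair dne {s = inG x a n} {notIn y n′ k} c s∈p t∈p with n ≟ n′
  ... | no n≢n′  = 0 , ⊥-elim ∘ n≢n′
  ... | yes refl = let i , xi≢yi = ≉ᵣ⇒∃≢ dne (proj₁ c x a n y k s∈p t∈p)
                   in suc i , λ _ → i , ≤-refl , xi≢yi
  separatedPair _ {s = inG _ _ _}   {inG _ _ _} _ _ _ = 0 , tt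
  separatedPair _ {s = inG _ _ _}   {cyl _ _ _} _ _ _ = 0 , tt
  separatedPair _ {s = notIn _ _ _}             _ _ _ = 0 , tt
  separatedPair _ {s = cyl _ _ _}               _ _ _ = 0 , tt

  separating-bound : DoubleNegationElimination 0ℓ → (p : Sentences) → Consistent p → ∃[ K ] Separates K p
  separating-bound dne p c =
    uniform-bound (λ K s → ∀ {t} → t ∈ p → SeparatedPair K s t)
                  (λ {_} {_} {s} K≤K′ sep t∈p → SeparatedPair-mono s _ K≤K′ (sep t∈p)) p
                  λ {s} s∈p → uniform-bound (λ K → SeparatedPair K s) (SeparatedPair-mono s _) p
                                            (separatedPair dne c s∈p)

  sketch : ℕ → Sentence A → Sketch
  sketch K (inG x _ n)   = inGˢ (restrict x K) n
  sketch K (notIn x n m) = notInˢ (restrict x K) n m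
  sketch K (cyl s n m)   = cylˢ s n m

  notInˢ-≡-sketch⁻ : ∀ {r m t} → notInˢ r n m ≡ sketch K t → ∃[ y ] t ≡ notIn y n m × restrict y K ≡ r
  notInˢ-≡-sketch⁻ {t = notIn y _ _} refl = y , refl , refl

  cylˢ-≡-sketch⁻ : ∀ {s m t} → cylˢ s n m ≡ sketch K t → t ≡ cyl s n m
  cylˢ-≡-sketch⁻ {t = cyl _ _ _} refl = refl

  same-sketch⇒Coherent : ∀ {p q} → Consistent p → Separates K p →
                         map (sketch K) p ≡ map (sketch K) q → Coherent p q
  same-sketch⇒Coherent {K} {p} {q} cp sep e = membership , cylinders
    where
    membership : MembershipCoherent p q
    membership x a n x′ k x∈p x′∈q x≈x′ with map-≡-∈⁻ e x′∈q
    ... | t , t∈p , eq with notInˢ-≡-sketch⁻ eq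
    ... | y , refl , y↾K≡x′↾K with sep x∈p t∈p refl
    ... | i , i<K , xi≢yi = xi≢yi (trans (x≈x′ i) (restrict-≡⇒≡ (sym y↾K≡x′↾K) i<K))

    cylinders : CylinderCoherent p q
    cylinders x n m s k x∈p s∈q with map-≡-∈⁻ e s∈q
    ... | t , t∈p , eq with cylˢ-≡-sketch⁻ eq
    ... | refl = proj₂ cp x n m s k x∈p t∈p

  sketchIndex : ℕ → Sentences → ℕ
  sketchIndex K p = index (unary ×ᶜ list sketchCode) (K , map (sketch K) p)

  code : DoubleNegationElimination 0ℓ → Cond A → ℕ
  code dne (p , c) = sketchIndex (proj₁ (separating-bound dne p c)) p

  same-sketchIndex⇒Consistent-++ : ∀ {p q} → Consistent p → Consistent q → Separates K p → Separates K′ q →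
                                   sketchIndex K p ≡ sketchIndex K′ q → Consistent (p ++ q)
  same-sketchIndex⇒Consistent-++ {K} {K′} {p} {q} cp cq sp sq e
    with ,-injective (index-injective (unary ×ᶜ list sketchCode)
                                      {K , map (sketch K) p} {K′ , map (sketch K′) q} e)
  ... | refl , same-sketch =
    Consistent-++ cp cq (same-sketch⇒Coherent cp sp same-sketch) (same-sketch⇒Coherent cq sq (sym same-sketch))

  same-code⇒Compatible : (dne : DoubleNegationElimination 0ℓ) (P Q : Cond A) →
                         code dne P ≡ code dne Q → Compatible P Q
  same-code⇒Compatible dne (p , cp) (q , cq) =
    same-sketchIndex⇒Consistent-++ cp cq (proj₂ (separating-bound dne p cp)) (proj₂ (separating-bound dne q cq))

lemma3 : ExcludedMiddle 0ℓ → (A : Real → Set) → CCC A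
lemma3 em A I p antichain =
  code dne ∘ p , λ i j same-code → antichain i j (same-code⇒Compatible dne (p i) (p j) same-code)
  where
  dne : DoubleNegationElimination 0ℓ
  dne = em⇒dne em
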